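{- $W(11,3) > 816$; that is, there exists a coloring of $\{1,2,\dots,816\}$ with $11$ colors containing no monochromatic arithmetic progression of length $3$.
   Context: For positive integers $r$ and $k$, the van der Waerden number $W(r,k)$ is the smallest positive integer $N$ such that for every coloring of the integers $\{1,2,\dots,N\}$ with $r$ colors there exist $k$ integers in arithmetic progression (with nonzero common difference) all of the same color. (Its existence is van der Waerden's theorem.) -}

module Defs where

open import Data.Nat using (ℕ; zero; suc; _+_; _*_; _≤_; _<_)
open import Data.Fin using (Fin)
open import Data.Product using (Σ; _×_; ∃-syntax)
open import Relation.Binary.PropositionalEquality using (_≡_)
open import Relation.Nullary using (¬_)

-- A coloring of {1,…,N} with r colors. Values outside {1,…,N} are never
-- inspected by the definitions below.
Coloring : ℕ → Set
Coloring r = ℕ → Fin r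

HasMonoAP : (N r k : ℕ) → Coloring r → Set
HasMonoAP N r k c =
  Σ ℕ λ a → Σ ℕ λ d →
    (1 ≤ d) ×
    ((i : ℕ) → i < k → (1 ≤ a + i * d) × (a + i * d ≤ N)) ×
    ((i : ℕ) → i < k → c (a + i * d) ≡ c a)

vdW-greater : (r k N : ℕ) → Set
vdW-greater r k N = Σ (Coloring r) λ c → ¬ HasMonoAP N r k c

module Submission where

-- The colouring is periodic modulo 419 and given by a table of its colours on
-- 0, …, 418; that it has no monochromatic 3-term progression in {1, …, 816} is
-- then a finite check, which the type checker carries out.

open import Data.Bool using (if_then_else_)
open import Data.Fin.Properties using (_≟_)
open import Data.List using (upTo)
open import Data.List.Membership.Propositional.Properties using (∈-upTo⁺)
open import Data.List.Relation.Unary.All using (All; all?; lookup)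
open import Data.Nat using (ℕ; zero; suc; _+_; _*_; _∸_; _≤_; _<_; _≡ᵇ_; _%_; _/_; s≤s; z≤n)
open import Data.Nat.DivMod using (_mod_)
open import Data.Nat.Properties using (≤-refl; n≮0; m+n≤o⇒m≤o; m+n≤o⇒n≤o; m+n≤o⇒m≤o∸n)
open import Data.Product using (_×_; _,_; proj₁; proj₂)
open import Relation.Binary.PropositionalEquality using (_≡_)
open import Relation.Nullary using (¬_; Dec; ¬?)
open import Relation.Nullary.Decidable using (_×-dec_; toWitness)

open import Defs

module _ {r : ℕ} (c : Coloring r) where

  MonoAP3 : ℕ → ℕ → Set
  MonoAP3 a d = c (a + 1 * d) ≡ c a × c (a + 2 * d) ≡ c a

  monoAP3? : ∀ a d → Dec (MonoAP3 a d)
  monoAP3? a d = c (a + 1 * d) ≟ c a ×-dec c (a + 2 * d) ≟ c a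

  -- Enumerates the progressions 1 + i, 1 + i + d, 1 + i + 2d with d = 1 + j,
  -- i.e. exactly those inside {1, …, N}.
  NoMonoAP3 : ℕ → Set
  NoMonoAP3 N = All (λ j → All (λ i → ¬ MonoAP3 (suc i) (suc j)) (upTo (N ∸ 2 * suc j))) (upTo N)

  noMonoAP3? : ∀ N → Dec (NoMonoAP3 N)
  noMonoAP3? N = all? (λ j → all? (λ i → ¬? (monoAP3? (suc i) (suc j))) (upTo (N ∸ 2 * suc j))) (upTo N)

  NoMonoAP3⇒¬HasMonoAP : ∀ {N} → NoMonoAP3 N → ¬ HasMonoAP N r 3 c
  NoMonoAP3⇒¬HasMonoAP _ (zero , d , _ , inRange , _) = n≮0 (proj₁ (inRange 0 (s≤s z≤n)))
  NoMonoAP3⇒¬HasMonoAP _ (suc i , zero , () , _)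
  NoMonoAP3⇒¬HasMonoAP {N} free (suc i , suc j , _ , inRange , mono) =
    lookup (lookup free (∈-upTo⁺ j<N)) (∈-upTo⁺ i<) (mono 1 (s≤s (s≤s z≤n)) , mono 2 ≤-refl)
    where
      last≤N : suc i + 2 * suc j ≤ N
      last≤N = proj₂ (inRange 2 ≤-refl)

      j<N : j < N
      j<N = m+n≤o⇒m≤o (suc j) (m+n≤o⇒n≤o (suc i) last≤N)

      i< : i < N ∸ 2 * suc j
      i< = m+n≤o⇒m≤o∸n (suc i) last≤N

data Trie (A : Set) : Set where
  leaf : A → Trie A
  node : Trie A → Trie A → Trie A

-- Keys are read in binary, least significant digit first; a leaf answers
-- every key that reaches it.
lookupTrie : {A : Set} → Trie A → ℕ → A
lookupTrie (leaf x)   _ = x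
lookupTrie (node l r) n = if n % 2 ≡ᵇ 0 then lookupTrie l (n / 2) else lookupTrie r (n / 2)

-- Subtrees holding only keys 419, …, 511, which are never looked up, are leaf 0.
colourTable : Trie ℕ
colourTable =
  node
    (node
      (node
        (node
          (node (node (node (node (node (leaf 4) (leaf 8)) (node (leaf 0) (leaf 4))) (node (node (leaf 1) (leaf 4)) (node (leaf 10) (leaf 0)))) (node (node (node (leaf 6) (leaf 0)) (node (leaf 8) (leaf 10))) (node (node (leaf 3) (leaf 1)) (node (leaf 6) (leaf 0))))) (node (node (node (node (leaf 2) (leaf 10)) (node (leaf 1) (leaf 5))) (node (node (leaf 3) (leaf 7)) (node (leaf 6) (leaf 0)))) (node (node (node (leaf 7) (leaf 8)) (node (leaf 6) (leaf 0))) (node (node (leaf 2) (leaf 5)) (node (leaf 0) (leaf 0))))))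
          (node (node (node (node (node (leaf 5) (leaf 7)) (node (leaf 6) (leaf 5))) (node (node (leaf 6) (leaf 0)) (node (leaf 4) (leaf 0)))) (node (node (node (leaf 1) (leaf 6)) (node (leaf 9) (leaf 0))) (node (node (leaf 7) (leaf 8)) (node (leaf 2) (leaf 0))))) (node (node (node (node (leaf 9) (leaf 1)) (node (leaf 3) (leaf 3))) (node (node (leaf 2) (leaf 3)) (node (leaf 3) (leaf 0)))) (node (node (node (leaf 5) (leaf 1)) (node (leaf 4) (leaf 0))) (node (node (leaf 10) (leaf 5)) (node (leaf 6) (leaf 0)))))))
        (node
          (node (node (node (node (node (leaf 0) (leaf 1)) (node (leaf 9) (leaf 8))) (node (node (leaf 7) (leaf 1)) (node (leaf 0) (leaf 0)))) (node (node (node (leaf 2) (leaf 5)) (node (leaf 1) (leaf 0))) (node (node (leaf 10) (leaf 8)) (node (leaf 10) (leaf 0))))) (node (node (node (node (leaf 9) (leaf 8)) (node (leaf 2) (leaf 2))) (node (node (leaf 4) (leaf 0)) (node (leaf 0) (leaf 0)))) (node (node (node (leaf 5) (leaf 5)) (node (leaf 3) (leaf 0))) (node (node (leaf 8) (leaf 1)) (node (leaf 6) (leaf 0))))))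
          (node (node (node (node (node (leaf 4) (leaf 4)) (node (leaf 9) (leaf 6))) (node (node (leaf 1) (leaf 0)) (node (leaf 1) (leaf 0)))) (node (node (node (leaf 5) (leaf 8)) (node (leaf 7) (leaf 0))) (node (node (leaf 7) (leaf 5)) (node (leaf 2) (leaf 0))))) (node (node (node (node (leaf 0) (leaf 1)) (node (leaf 9) (leaf 1))) (node (node (leaf 10) (leaf 5)) (node (leaf 1) (leaf 0)))) (node (node (node (leaf 6) (leaf 5)) (node (leaf 0) (leaf 0))) (node (node (leaf 7) (leaf 4)) (node (leaf 2) (leaf 0))))))))
      (node
        (node
          (node (node (node (node (node (leaf 10) (leaf 6)) (node (leaf 6) (leaf 0))) (node (node (leaf 4) (leaf 3)) (node (leaf 0) (leaf 0)))) (node (node (node (leaf 5) (leaf 9)) (node (leaf 6) (leaf 1))) (node (node (leaf 10) (leaf 9)) (node (leaf 3) (leaf 0))))) (node (node (node (node (leaf 5) (leaf 5)) (node (leaf 4) (leaf 8))) (node (node (leaf 6) (leaf 9)) (node (leaf 7) (leaf 0)))) (node (node (node (leaf 3) (leaf 6)) (node (leaf 3) (leaf 0))) (node (node (leaf 6) (leaf 1)) (node (leaf 5) (leaf 0))))))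
          (node (node (node (node (node (leaf 2) (leaf 9)) (node (leaf 0) (leaf 6))) (node (node (leaf 5) (leaf 6)) (node (leaf 8) (leaf 0)))) (node (node (node (leaf 8) (leaf 8)) (node (leaf 1) (leaf 0))) (node (node (leaf 1) (leaf 9)) (node (leaf 7) (leaf 0))))) (node (node (node (node (leaf 4) (leaf 8)) (node (leaf 0) (leaf 8))) (node (node (leaf 1) (leaf 0)) (node (leaf 10) (leaf 0)))) (node (node (node (leaf 0) (leaf 2)) (node (leaf 9) (leaf 0))) (node (node (leaf 2) (leaf 9)) (node (leaf 5) (leaf 0)))))))
        (node
          (node (node (node (node (node (leaf 8) (leaf 4)) (node (leaf 10) (leaf 3))) (node (node (leaf 2) (leaf 5)) (node (leaf 2) (leaf 0)))) (node (node (node (leaf 9) (leaf 8)) (node (leaf 1) (leaf 0))) (node (node (leaf 9) (leaf 4)) (node (leaf 5) (leaf 0))))) (node (node (node (node (leaf 0) (leaf 10)) (node (leaf 0) (leaf 0))) (node (node (leaf 9) (leaf 3)) (node (leaf 10) (leaf 0)))) (node (node (node (leaf 9) (leaf 1)) (node (leaf 4) (leaf 0))) (node (node (leaf 5) (leaf 7)) (node (leaf 3) (leaf 0))))))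
          (node (node (node (node (node (leaf 10) (leaf 10)) (node (leaf 9) (leaf 10))) (node (node (leaf 2) (leaf 7)) (node (leaf 9) (leaf 0)))) (node (node (node (leaf 3) (leaf 2)) (node (leaf 4) (leaf 0))) (node (node (leaf 9) (leaf 7)) (node (leaf 5) (leaf 0))))) (node (node (node (node (leaf 7) (leaf 5)) (node (leaf 4) (leaf 4))) (node (node (leaf 10) (leaf 3)) (node (leaf 9) (leaf 0)))) (node (node (node (leaf 5) (leaf 10)) (node (leaf 10) (leaf 0))) (node (node (leaf 5) (leaf 8)) (node (leaf 9) (leaf 0)))))))))
    (node
      (node
        (node
          (node (node (node (node (node (leaf 6) (leaf 7)) (node (leaf 2) (leaf 2))) (node (node (leaf 2) (leaf 3)) (node (leaf 10) (leaf 0)))) (node (node (node (leaf 8) (leaf 7)) (node (leaf 7) (leaf 3))) (node (node (leaf 1) (leaf 5)) (node (leaf 10) (leaf 0))))) (node (node (node (node (leaf 4) (leaf 8)) (node (leaf 4) (leaf 4))) (node (node (leaf 2) (leaf 7)) (node (leaf 9) (leaf 0)))) (node (node (node (leaf 6) (leaf 1)) (node (leaf 4) (leaf 0))) (node (node (leaf 1) (leaf 1)) (node (leaf 10) (leaf 0))))))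
          (node (node (node (node (node (leaf 0) (leaf 8)) (node (leaf 0) (leaf 8))) (node (node (leaf 10) (leaf 6)) (node (leaf 0) (leaf 0)))) (node (node (node (leaf 2) (leaf 9)) (node (leaf 4) (leaf 0))) (node (node (leaf 5) (leaf 10)) (node (leaf 7) (leaf 0))))) (node (node (node (node (leaf 7) (leaf 10)) (node (leaf 7) (leaf 5))) (node (node (leaf 1) (leaf 4)) (node (leaf 4) (leaf 0)))) (node (node (node (leaf 7) (leaf 3)) (node (leaf 9) (leaf 0))) (node (node (leaf 0) (leaf 0)) (node (leaf 3) (leaf 0)))))))
        (node
          (node (node (node (node (node (leaf 8) (leaf 8)) (node (leaf 2) (leaf 9))) (node (node (leaf 1) (leaf 3)) (node (leaf 2) (leaf 0)))) (node (node (node (leaf 0) (leaf 4)) (node (leaf 7) (leaf 0))) (node (node (leaf 0) (leaf 2)) (node (leaf 0) (leaf 0))))) (node (node (node (node (leaf 3) (leaf 7)) (node (leaf 3) (leaf 3))) (node (node (leaf 6) (leaf 5)) (node (leaf 7) (leaf 0)))) (node (node (node (leaf 6) (leaf 7)) (node (leaf 2) (leaf 0))) (node (node (leaf 5) (leaf 1)) (node (leaf 8) (leaf 0))))))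
          (node (node (node (node (node (leaf 10) (leaf 10)) (node (leaf 3) (leaf 8))) (node (node (leaf 10) (leaf 2)) (node (leaf 3) (leaf 0)))) (node (node (node (leaf 9) (leaf 4)) (node (leaf 1) (leaf 0))) (node (node (leaf 3) (leaf 2)) (node (leaf 8) (leaf 0))))) (node (node (node (node (leaf 1) (leaf 0)) (node (leaf 8) (leaf 0))) (node (node (leaf 2) (leaf 5)) (node (leaf 9) (leaf 0)))) (node (node (node (leaf 5) (leaf 7)) (node (leaf 4) (leaf 0))) (node (node (leaf 0) (leaf 7)) (node (leaf 3) (leaf 0))))))))
      (node
        (node
          (node (node (node (node (node (leaf 3) (leaf 0)) (node (leaf 10) (leaf 7))) (node (node (leaf 3) (leaf 1)) (node (leaf 7) (leaf 0)))) (node (node (node (leaf 8) (leaf 10)) (node (leaf 4) (leaf 0))) (node (node (leaf 5) (leaf 3)) (node (leaf 0) (leaf 0))))) (node (node (node (node (leaf 2) (leaf 3)) (node (leaf 3) (leaf 9))) (node (node (leaf 6) (leaf 10)) (node (leaf 1) (leaf 0)))) (node (node (node (leaf 2) (leaf 9)) (node (leaf 8) (leaf 0))) (node (node (leaf 0) (leaf 6)) (node (leaf 7) (leaf 0))))))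
          (node (node (node (node (node (leaf 10) (leaf 10)) (node (leaf 6) (leaf 2))) (node (node (leaf 1) (leaf 9)) (node (leaf 1) (leaf 0)))) (node (node (node (leaf 4) (leaf 3)) (node (leaf 1) (leaf 0))) (node (node (leaf 6) (leaf 4)) (node (leaf 8) (leaf 0))))) (node (node (node (node (leaf 4) (leaf 1)) (node (leaf 6) (leaf 4))) (node (node (leaf 10) (leaf 7)) (node (leaf 8) (leaf 0)))) (node (node (node (leaf 0) (leaf 9)) (node (leaf 5) (leaf 0))) (node (node (leaf 7) (leaf 6)) (node (leaf 2) (leaf 0)))))))
        (node
          (node (node (node (node (node (leaf 6) (leaf 7)) (node (leaf 6) (leaf 8))) (node (node (leaf 2) (leaf 0)) (node (leaf 6) (leaf 0)))) (node (node (node (leaf 8) (leaf 9)) (node (leaf 9) (leaf 0))) (node (node (leaf 2) (leaf 1)) (node (leaf 8) (leaf 0))))) (node (node (node (node (leaf 7) (leaf 7)) (node (leaf 8) (leaf 5))) (node (node (leaf 10) (leaf 6)) (node (leaf 6) (leaf 0)))) (node (node (node (leaf 2) (leaf 6)) (node (leaf 9) (leaf 0))) (node (node (leaf 4) (leaf 4)) (node (leaf 6) (leaf 0))))))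
          (node (node (node (node (node (leaf 5) (leaf 9)) (node (leaf 4) (leaf 7))) (node (node (leaf 10) (leaf 5)) (node (leaf 10) (leaf 0)))) (node (node (node (leaf 6) (leaf 4)) (node (leaf 7) (leaf 0))) (node (node (leaf 4) (leaf 2)) (node (leaf 10) (leaf 0))))) (node (node (node (node (leaf 4) (leaf 2)) (node (leaf 3) (leaf 8))) (node (node (leaf 3) (leaf 9)) (node (leaf 8) (leaf 0)))) (node (node (node (leaf 0) (leaf 0)) (node (leaf 3) (leaf 0))) (node (node (leaf 2) (leaf 9)) (node (leaf 3) (leaf 0)))))))))

colouring : Coloring 11
colouring n = lookupTrie colourTable (n % 419) mod 11

mainTheorem5 : vdW-greater 11 3 816
mainTheorem5 =
  colouring , NoMonoAP3⇒¬HasMonoAP colouring (toWitness {a? = noMonoAP3? colouring 816} _)
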